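{- Let $n\ge1$ and let $\pi$ be a permutation of $\mathbb{Z}_n=\{0,\dots,n-1\}$, and let $c$ be one of its cycles, of length $\ell$, with minimum element $x$, so $c=\{\pi^0(x),\pi^1(x),\dots,\pi^{\ell-1}(x)\}$. Let $p=n+1$, $\varphi(i)=ip\bmod n^2$ for $i\in\mathbb{Z}_{n^2}$, and for $t,g\in\mathbb{Z}_n$ let $f(t,g)=\varphi(gn+((t-g)\bmod n))$. Define words $u^{c}=u^c_0\cdots u^c_{n^2-1}$ and $v^{c}=v^c_0\cdots v^c_{n^2-1}$ over $\mathbb{Z}_n$ as follows. Call the positions $f(\pi^k(x),k)$, $k\in\mathbb{Z}_\ell$, distinguished, and set $u^c_{f(\pi^k(x),k)}=\pi^k(x)$ and $v^c_{f(\pi^k(x),k)}=\pi^{k+1}(x)$. Write $a_i=u^c_{\varphi(i)}$, $b_i=v^c_{\varphi(i)}$, and let $q\in\mathbb{Z}_{n^2}$ be such that $\varphi(q)=f(x,0)$. For $i=q+1,q+2,\dots,n^2-1,0,1,\dots,q-1$ in this order, if $\varphi(i)$ is not distinguished set $a_i=b_{i-1}$ and $b_i=b_{i-1}$ (indices modulo $n^2$). Then $R_p(u^c)$ and $R_p(v^c)$ are cyclically equivalent with offset $1$, i.e. $b_i=a_{(i+1)\bmod n^2}$ for all $i\in\mathbb{Z}_{n^2}$.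
   Context: For $w=w_0\cdots w_{N-1}$ and $\gcd(p,N)=1$, the reading with step size $p$ is $R_p(w)=w_0w_pw_{2p}\cdots w_{(N-1)p}$ (indices modulo $N$); thus $R_p(u^c)=a_0\cdots a_{n^2-1}$ and $R_p(v^c)=b_0\cdots b_{n^2-1}$. Words $x,y$ of length $N$ are cyclically equivalent with offset $r$ if $y_j=x_{(j+r)\bmod N}$ for all $j$. -}

module Defs where

open import Data.Nat using (ℕ; zero; suc; _+_; _*_; _∸_; _<_; _≤_; NonZero)
open import Data.Nat.DivMod using (_%_)
open import Data.Nat.Properties using (m*n≢0)
open import Data.Fin using (Fin; toℕ)
open import Data.Fin.Permutation using (Permutation′; _⟨$⟩ʳ_)
open import Data.Empty using (⊥)
open import Data.Product using (∃-syntax; _×_)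
open import Relation.Binary.PropositionalEquality using (_≡_)

-- Words of length N over Z_n are represented as functions ℕ → Fin n,
-- of which only the values at positions 0 … N-1 are meaningful.
Word : ℕ → Set
Word n = ℕ → Fin n

iter : ∀ {n} → Permutation′ n → ℕ → Fin n → Fin n
iter π zero    x = x
iter π (suc k) x = π ⟨$⟩ʳ iter π k x

R : (N : ℕ) .{{_ : NonZero N}} → ℕ → ∀ {n} → Word n → Word n
R N p w j = w ((j * p) % N)

CycEquiv : (N : ℕ) .{{_ : NonZero N}} → ℕ → ∀ {n} → Word n → Word n → Set
CycEquiv N r x y = ∀ j → j < N → y j ≡ x ((j + r) % N)

instance
  nonZero-sq : ∀ {n} .{{_ : NonZero n}} → NonZero (n * n)
  nonZero-sq {n} = m*n≢0 n n

φ : (n : ℕ) .{{_ : NonZero n}} → ℕ → ℕ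
φ n i = (i * suc n) % (n * n)

f : (n : ℕ) .{{_ : NonZero n}} → ℕ → ℕ → ℕ
f n t g = φ n (g * n + ((t + n ∸ g) % n))

Distinguished : (n : ℕ) .{{_ : NonZero n}} → Permutation′ n → Fin n → ℕ → ℕ → Set
Distinguished n π x ℓ j = ∃[ k ] (k < ℓ × f n (toℕ (iter π k x)) k ≡ j)

IsMinOfCycleOfLength : ∀ {n} → Permutation′ n → Fin n → ℕ → Set
IsMinOfCycleOfLength π x ℓ =
  (1 ≤ ℓ) × (iter π ℓ x ≡ x)
  × (∀ k → 1 ≤ k → k < ℓ → iter π k x ≡ x → ⊥)
  × (∀ k → toℕ x ≤ toℕ (iter π k x))

{-# OPTIONS --safe #-}
-- Since n + 1 is invertible modulo n², φ is a bijection of Z_{n²}, so in the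
-- readings a = R_p(u^c), b = R_p(v^c) the distinguished positions become the
-- indices d_k = k n + ((π^k(x) − k) mod n), k < ℓ. Each d_k lies in the k-th
-- block of length n, so they increase strictly, and ℓ ≤ n keeps them below n².
-- Away from the d_k the word b is constant, so just before d_k it still carries
-- b_{d_{k−1}} = π^k(x) = a_{d_k}; just before d_0 the run wraps around from
-- d_{ℓ−1}, whose value is π^ℓ(x) = x = a_{d_0}.
module Submission where

open import Defs
open import Data.Nat using (ℕ; zero; suc; pred; _+_; _*_; _∸_; _<_; _≤_; NonZero; z≤n; s≤s; z<s; _≟_)
open import Data.Nat.Properties
open import Data.Nat.DivMod using (_%_; %-distribˡ-*; m%n%n≡m%n; [m+kn]%n≡m%n; [m+n]%n≡m%n; m<n⇒m%n≡m; m%n<n; n%n≡0)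
open import Data.Nat.Solver using (module +-*-Solver)
open import Data.Fin as Fin using (Fin; toℕ)
open import Data.Fin.Properties using (toℕ<n; pigeonhole)
open import Data.Fin.Permutation using (Permutation′; _⟨$⟩ʳ_; _⟨$⟩ˡ_; inverseˡ)
open import Data.Product using (_×_; _,_; proj₁; proj₂; ∃-syntax)
open import Data.Empty using (⊥)
open import Data.Sum using (_⊎_; inj₁; inj₂)
open import Relation.Nullary using (¬_; Dec; yes; no)
open import Relation.Binary.PropositionalEquality using (_≡_; _≢_; refl; sym; trans; cong; cong₂; subst; module ≡-Reasoning)

*-%-cancelʳ : ∀ N .{{_ : NonZero N}} {p c k i j} → p * c ≡ 1 + k * N →
             i < N → j < N → (i * p) % N ≡ (j * p) % N → i ≡ j
*-%-cancelʳ N {p} {c} {k} {i} {j} pc≡1 i<N j<N ip≡jp = begin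
  i                     ≡⟨ undo i<N ⟨
  ((i * p) % N * c) % N ≡⟨ cong (λ m → (m * c) % N) ip≡jp ⟩
  ((j * p) % N * c) % N ≡⟨ undo j<N ⟩
  j                     ∎
  where
  open ≡-Reasoning
  undo : ∀ {m} → m < N → ((m * p) % N * c) % N ≡ m
  undo {m} m<N = begin
    ((m * p) % N * c) % N           ≡⟨ %-distribˡ-* ((m * p) % N) c N ⟩
    ((m * p) % N % N * (c % N)) % N ≡⟨ cong (λ r → (r * (c % N)) % N) (m%n%n≡m%n (m * p) N) ⟩
    ((m * p) % N * (c % N)) % N     ≡⟨ %-distribˡ-* (m * p) c N ⟨
    (m * p * c) % N                 ≡⟨ cong (_% N) (*-assoc m p c) ⟩
    (m * (p * c)) % N               ≡⟨ cong (λ r → (m * r) % N) pc≡1 ⟩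
    (m * (1 + k * N)) % N           ≡⟨ cong (_% N) (*-distribˡ-+ m 1 (k * N)) ⟩
    (m * 1 + m * (k * N)) % N       ≡⟨ cong (_% N) (cong₂ _+_ (*-identityʳ m) (sym (*-assoc m k N))) ⟩
    (m + m * k * N) % N             ≡⟨ [m+kn]%n≡m%n m (m * k) N ⟩
    m % N                           ≡⟨ m<n⇒m%n≡m m<N ⟩
    m                               ∎

-- (n + 1)(n² − n + 1) = 1 + n · n², written with n = m + 1 to avoid truncated subtraction.
φ-injective : ∀ n .{{_ : NonZero n}} {i j} → i < n * n → j < n * n → φ n i ≡ φ n j → i ≡ j
φ-injective (suc m) = *-%-cancelʳ (suc m * suc m) {c = m * suc m + 1} {k = suc m} unit
  where
  open +-*-Solver
  unit : suc (suc m) * (m * suc m + 1) ≡ 1 + suc m * (suc m * suc m)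
  unit = solve 1 (λ m → (con 2 :+ m) :* (m :* (con 1 :+ m) :+ con 1)
                      := con 1 :+ (con 1 :+ m) :* ((con 1 :+ m) :* (con 1 :+ m))) refl m

*-+-< : ∀ {n k k' r} → r < n → k < k' → k * n + r < k' * n
*-+-< {n} {k} {k'} {r} r<n k<k' = begin-strict
  k * n + r ≡⟨ +-comm (k * n) r ⟩
  r + k * n <⟨ +-monoˡ-< (k * n) r<n ⟩
  suc k * n ≤⟨ *-monoˡ-≤ n k<k' ⟩
  k' * n    ∎
  where open ≤-Reasoning

iter-+ : ∀ {n} (π : Permutation′ n) i r x → iter π (i + r) x ≡ iter π i (iter π r x)
iter-+ π zero    r x = refl
iter-+ π (suc i) r x = cong (π ⟨$⟩ʳ_) (iter-+ π i r x)

iter-injective : ∀ {n} (π : Permutation′ n) i {x y} → iter π i x ≡ iter π i y → x ≡ y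
iter-injective π zero    eq = eq
iter-injective π (suc i) {x} {y} eq = iter-injective π i (begin
  iter π i x                       ≡⟨ inverseˡ π ⟨
  π ⟨$⟩ˡ (π ⟨$⟩ʳ iter π i x) ≡⟨ cong (π ⟨$⟩ˡ_) eq ⟩
  π ⟨$⟩ˡ (π ⟨$⟩ʳ iter π i y) ≡⟨ inverseˡ π ⟩
  iter π i y                       ∎)
  where open ≡-Reasoning

orbit-length≤n : ∀ {n} (π : Permutation′ n) x ℓ →
                 (∀ k → 1 ≤ k → k < ℓ → iter π k x ≢ x) → ℓ ≤ n
orbit-length≤n {n} π x ℓ no-early-return =
  ≮⇒≥ λ n<ℓ → repeat (pigeonhole (n<1+n n) (λ i → iter π (toℕ i) x)) n<ℓ
  where
  open ≡-Reasoning
  repeat : ∃[ i ] ∃[ j ] (i Fin.< j × iter π (toℕ i) x ≡ iter π (toℕ j) x) → n < ℓ → ⊥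
  repeat (i , j , i<j , eq) n<ℓ = no-early-return r (m<n⇒0<n∸m i<j) r<ℓ (sym x≡πʳx)
    where
    r = toℕ j ∸ toℕ i
    r<ℓ : r < ℓ
    r<ℓ = ≤-<-trans (m∸n≤m (toℕ j) (toℕ i)) (<-≤-trans (toℕ<n j) n<ℓ)
    x≡πʳx : x ≡ iter π r x
    x≡πʳx = iter-injective π (toℕ i) (begin
      iter π (toℕ i) x            ≡⟨ eq ⟩
      iter π (toℕ j) x            ≡⟨ cong (λ m → iter π m x) (m+[n∸m]≡n (<⇒≤ i<j)) ⟨
      iter π (toℕ i + r) x        ≡⟨ iter-+ π (toℕ i) r x ⟩
      iter π (toℕ i) (iter π r x) ∎)

stable-between : ∀ {A : Set} (g : ℕ → A) {i j} → i ≤ j →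
                 (∀ {m} → i ≤ m → m < j → g (suc m) ≡ g m) → g j ≡ g i
stable-between g {j = zero}  z≤n   step = refl
stable-between g {j = suc j} i≤1+j step with m≤n⇒m<n∨m≡n i≤1+j
... | inj₁ i<1+j = trans (step (<⇒≤pred i<1+j) ≤-refl)
                         (stable-between g (<⇒≤pred i<1+j) (λ i≤m m<j → step i≤m (m<n⇒m<1+n m<j)))
... | inj₂ refl  = refl

predMod : (N : ℕ) .{{_ : NonZero N}} → ℕ → ℕ
predMod N i = (i + N ∸ 1) % N

module _ (N : ℕ) .{{_ : NonZero N}} where

  pred<N : pred N < N
  pred<N = ≤-reflexive (suc-pred N)

  predMod-zero : predMod N 0 ≡ pred N
  predMod-zero = m<n⇒m%n≡m pred<N

  predMod-suc : ∀ {m} → m < N → predMod N (suc m) ≡ m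
  predMod-suc {m} m<N = trans ([m+n]%n≡m%n m N) (m<n⇒m%n≡m m<N)

  predMod-sucMod : ∀ {j} → j < N → predMod N ((j + 1) % N) ≡ j
  predMod-sucMod {j} j<N =
    trans (cong (λ m → predMod N (m % N)) (+-comm j 1)) (wrap? (m≤n⇒m<n∨m≡n j<N))
    where
    open ≡-Reasoning
    wrap? : suc j < N ⊎ suc j ≡ N → predMod N (suc j % N) ≡ j
    wrap? (inj₁ 1+j<N) = trans (cong (predMod N) (m<n⇒m%n≡m 1+j<N)) (predMod-suc j<N)
    wrap? (inj₂ 1+j≡N) = begin
      predMod N (suc j % N) ≡⟨ cong (λ m → predMod N (m % N)) 1+j≡N ⟩
      predMod N (N % N)     ≡⟨ cong (predMod N) (n%n≡0 N) ⟩
      predMod N 0           ≡⟨ predMod-zero ⟩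
      pred N                ≡⟨ cong pred 1+j≡N ⟨
      j                     ∎

AmongFirst : ℕ → (ℕ → ℕ) → ℕ → Set
AmongFirst ℓ d i = ∃[ k ] (k < ℓ × d k ≡ i)

amongFirst? : ∀ ℓ d i → Dec (AmongFirst ℓ d i)
amongFirst? ℓ d i = anyUpTo? (λ k → d k ≟ i) ℓ

module CyclicRun {A : Set} (N : ℕ) .{{_ : NonZero N}} (a b t : ℕ → A) (ℓ : ℕ) (d : ℕ → ℕ)
  (d-mono : ∀ {k k'} → k < k' → d k < d k')
  (d<N : ∀ {k} → k < ℓ → d k < N)
  (t-periodic : t ℓ ≡ t 0)
  (a-marked : ∀ k → k < ℓ → a (d k) ≡ t k)
  (b-marked : ∀ k → k < ℓ → b (d k) ≡ t (suc k))
  (unmarked : ∀ i → i < N → ¬ AmongFirst ℓ d i → a i ≡ b (predMod N i) × b i ≡ b (predMod N i))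
  where

  open ≡-Reasoning

  d-mono-≤ : ∀ {k k'} → k ≤ k' → d k ≤ d k'
  d-mono-≤ k≤k' with m≤n⇒m<n∨m≡n k≤k'
  ... | inj₁ k<k' = <⇒≤ (d-mono k<k')
  ... | inj₂ refl = ≤-refl

  unmarked-before-first : ∀ {m} → m < d 0 → ¬ AmongFirst ℓ d m
  unmarked-before-first m<d₀ (k , _ , refl) = <-irrefl refl (<-≤-trans m<d₀ (d-mono-≤ z≤n))

  unmarked-between : ∀ {k m} → d k < m → m < d (suc k) → ¬ AmongFirst ℓ d m
  unmarked-between {k} dₖ<m m<dₖ₊₁ (k' , _ , refl) with ≤-<-connex k' k
  ... | inj₁ k'≤k = <-irrefl refl (≤-<-trans (d-mono-≤ k'≤k) dₖ<m)
  ... | inj₂ k<k' = <-irrefl refl (<-≤-trans m<dₖ₊₁ (d-mono-≤ k<k'))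

  unmarked-after-last : ∀ {L m} → suc L ≡ ℓ → d L < m → ¬ AmongFirst ℓ d m
  unmarked-after-last refl dL<m (k , k<ℓ , refl) =
    <-irrefl refl (≤-<-trans (d-mono-≤ (<⇒≤pred k<ℓ)) dL<m)

  b-stable : ∀ {i j} → i ≤ j → j < N → (∀ {m} → i < m → m ≤ j → ¬ AmongFirst ℓ d m) → b j ≡ b i
  b-stable {i} {j} i≤j j<N no-mark = stable-between b i≤j step
    where
    step : ∀ {m} → i ≤ m → m < j → b (suc m) ≡ b m
    step {m} i≤m m<j = begin
      b (suc m)             ≡⟨ proj₂ (unmarked (suc m) (≤-<-trans m<j j<N) (no-mark (s≤s i≤m) m<j)) ⟩
      b (predMod N (suc m)) ≡⟨ cong b (predMod-suc N (<-trans m<j j<N)) ⟩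
      b m                   ∎

  b-wrap : 0 < ℓ → b (pred N) ≡ t 0
  b-wrap 0<ℓ = begin
    b (pred N)    ≡⟨ b-stable (<⇒≤pred (d<N L<ℓ)) (pred<N N)
                              (λ dL<m _ → unmarked-after-last 1+L≡ℓ dL<m) ⟩
    b (d L)       ≡⟨ b-marked L L<ℓ ⟩
    t (suc L)     ≡⟨ cong t 1+L≡ℓ ⟩
    t ℓ           ≡⟨ t-periodic ⟩
    t 0           ∎
    where
    L = pred ℓ
    1+L≡ℓ : suc L ≡ ℓ
    1+L≡ℓ = m+[n∸m]≡n 0<ℓ
    L<ℓ : L < ℓ
    L<ℓ = ≤-reflexive 1+L≡ℓ

  b-before-mark : ∀ k → k < ℓ → b (predMod N (d k)) ≡ t k
  b-before-mark zero 0<ℓ with d 0 in d₀≡ | d<N 0<ℓ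
  ... | zero  | _ = trans (cong b (predMod-zero N)) (b-wrap 0<ℓ)
  ... | suc m | 1+m<N = begin
    b (predMod N (suc m)) ≡⟨ cong b (predMod-suc N m<N) ⟩
    b m                   ≡⟨ b-stable z≤n m<N (λ _ j≤m → unmarked-before-first (before (s≤s j≤m))) ⟩
    b 0                   ≡⟨ proj₂ (unmarked 0 (≤-<-trans z≤n m<N)
                                                 (unmarked-before-first (before z<s))) ⟩
    b (predMod N 0)       ≡⟨ cong b (predMod-zero N) ⟩
    b (pred N)            ≡⟨ b-wrap 0<ℓ ⟩
    t 0                   ∎
    where
    m<N : m < N
    m<N = <-trans (n<1+n m) 1+m<N
    before : ∀ {j} → j < suc m → j < d 0
    before j<1+m = subst (_ <_) (sym d₀≡) j<1+m
  b-before-mark (suc k) 1+k<ℓ with d (suc k) in dₖ₊₁≡ | d-mono (n<1+n k) | d<N 1+k<ℓ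
  ... | suc m | dₖ<1+m | 1+m<N = begin
    b (predMod N (suc m)) ≡⟨ cong b (predMod-suc N m<N) ⟩
    b m                   ≡⟨ b-stable (<⇒≤pred dₖ<1+m) m<N
                                 (λ dₖ<j j≤m → unmarked-between dₖ<j (next (s≤s j≤m))) ⟩
    b (d k)               ≡⟨ b-marked k (<-trans (n<1+n k) 1+k<ℓ) ⟩
    t (suc k)             ∎
    where
    m<N : m < N
    m<N = <-trans (n<1+n m) 1+m<N
    next : ∀ {j} → j < suc m → j < d (suc k)
    next j<1+m = subst (_ <_) (sym dₖ₊₁≡) j<1+m

  b≡a-next : ∀ j → j < N → b j ≡ a ((j + 1) % N)
  b≡a-next j j<N with amongFirst? ℓ d ((j + 1) % N)
  ... | no unmarked-i = sym (begin
    a i                 ≡⟨ proj₁ (unmarked i (m%n<n (j + 1) N) unmarked-i) ⟩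
    b (predMod N i)     ≡⟨ cong b (predMod-sucMod N j<N) ⟩
    b j                 ∎)
    where i = (j + 1) % N
  ... | yes (k , k<ℓ , dₖ≡i) = begin
    b j                 ≡⟨ cong b (predMod-sucMod N j<N) ⟨
    b (predMod N i)     ≡⟨ cong (λ m → b (predMod N m)) dₖ≡i ⟨
    b (predMod N (d k)) ≡⟨ b-before-mark k k<ℓ ⟩
    t k                 ≡⟨ a-marked k k<ℓ ⟨
    a (d k)             ≡⟨ cong a dₖ≡i ⟩
    a i                 ∎
    where i = (j + 1) % N

lemma7 : (n : ℕ) .{{_ : NonZero n}} (π : Permutation′ n) (x : Fin n) (ℓ : ℕ) →
    IsMinOfCycleOfLength π x ℓ →
    (u v : Word n) →
    (∀ k → k < ℓ → u (f n (toℕ (iter π k x)) k) ≡ iter π k x) →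
    (∀ k → k < ℓ → v (f n (toℕ (iter π k x)) k) ≡ iter π (suc k) x) →
    (q : ℕ) → q < n * n → φ n q ≡ f n (toℕ x) 0 →
    (∀ i → i < n * n → i ≢ q → ¬ Distinguished n π x ℓ (φ n i) →
      (R (n * n) (suc n) u i
         ≡ R (n * n) (suc n) v (((i + n * n) ∸ 1) % (n * n)))
      × (R (n * n) (suc n) v i
         ≡ R (n * n) (suc n) v (((i + n * n) ∸ 1) % (n * n)))) →
    CycEquiv (n * n) 1 (R (n * n) (suc n) u) (R (n * n) (suc n) v)
lemma7 n π x ℓ (0<ℓ , returns , no-early-return , _) u v u-marked v-marked q q<N φq≡ rule =
  CyclicRun.b≡a-next (n * n) a b (λ k → iter π k x) ℓ d
    d-mono d<N returns u-marked v-marked unmarked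
  where
  a b : Word n
  a = R (n * n) (suc n) u
  b = R (n * n) (suc n) v

  d : ℕ → ℕ
  d k = k * n + (toℕ (iter π k x) + n ∸ k) % n

  d-mono : ∀ {k k'} → k < k' → d k < d k'
  d-mono k<k' = <-≤-trans (*-+-< (m%n<n _ n) k<k') (m≤m+n _ _)

  d<N : ∀ {k} → k < ℓ → d k < n * n
  d<N k<ℓ = <-≤-trans (*-+-< (m%n<n _ n) k<ℓ) (*-monoˡ-≤ n (orbit-length≤n π x ℓ no-early-return))

  unmarked : ∀ i → i < n * n → ¬ AmongFirst ℓ d i →
             a i ≡ b (predMod (n * n) i) × b i ≡ b (predMod (n * n) i)
  unmarked i i<N i-unmarked = rule i i<N i≢q λ (k , k<ℓ , φdₖ≡φi) →
    i-unmarked (k , k<ℓ , φ-injective n (d<N k<ℓ) i<N φdₖ≡φi)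
    where
    i≢q : i ≢ q
    i≢q refl = i-unmarked (0 , 0<ℓ , φ-injective n (d<N 0<ℓ) q<N (sym φq≡))
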